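{- The rules $(\to R)$, $(\Box R)$, $(@R)$ and $(@L)$ are invertible in $\mathsf{T}\mathbf{EFL}$: whenever the conclusion of an instance of one of these rules is provable in $\mathsf{T}\mathbf{EFL}$, its premise is provable in $\mathsf{T}\mathbf{EFL}$. Explicitly: if $\Gamma\stackrel{\mathcal{T}}{\Rightarrow}\Delta,\alpha:@_n(\varphi\to\psi)$ is provable then so is $\alpha:@_n\varphi,\Gamma\stackrel{\mathcal{T}}{\Rightarrow}\Delta,\alpha:@_n\psi$; if $\Gamma\stackrel{\mathcal{T}}{\Rightarrow}\Delta,\alpha:@_n\Box\varphi$ is provable then so is $\Gamma\stackrel{\mathcal{T}\cup\{\alpha\cdot_ni\}}{\Rightarrow}\Delta,\alpha\cdot_ni:@_n\varphi$ for $i$ fresh (i.e. $\alpha\cdot_ni\notin\mathcal{T}$); if $\Gamma\stackrel{\mathcal{T}}{\Rightarrow}\Delta,\alpha:@_n@_m\varphi$ is provable then so is $\Gamma\stackrel{\mathcal{T}}{\Rightarrow}\Delta,\alpha:@_m\varphi$; if $\alpha:@_n@_m\varphi,\Gamma\stackrel{\mathcal{T}}{\Rightarrow}\Delta$ is provable then so is $\alpha:@_m\varphi,\Gamma\stackrel{\mathcal{T}}{\Rightarrow}\Delta$.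
   Context: Syntax. Disjoint countably infinite sets $\mathsf{Prop}$ and $\mathsf{Nom}$ (agent nominals). Formulas: $\varphi ::= n \mid p \mid \bot \mid \varphi\to\varphi \mid @_{n}\varphi \mid \mathsf{F}\varphi \mid \Box\varphi$; $\neg\varphi:=\varphi\to\bot$; $\langle\mathsf{F}\rangle\varphi:=\neg\mathsf{F}\neg\varphi$. $@$-prefixed formulas have the form $@_n\varphi$. $\varphi[m/k]$ replaces every occurrence of nominal $k$ by $m$. Tree sequents. Labels: natural numbers, and $\alpha\cdot_ni$ (an $n$-child of $\alpha$) for label $\alpha$, nominal $n$, $i\in\mathbb{N}$. A tree: set of labels containing exactly one natural number (root), closed under parents. Labelled formula: $\alpha:\psi$, $\psi$ $@$-prefixed. Tree sequent $\Gamma\stackrel{\mathcal{T}}{\Rightarrow}\Delta$: finite sets of labelled formulas, finite tree containing their labels. Calculus $\mathsf{T}\mathbf{EFL}$ ($\alpha,\beta\in\mathcal{T}$; tree unchanged unless indicated). Initial: $\alpha:@_n\bot,\Gamma\Rightarrow\Delta$; $\alpha:@_n\varphi,\Gamma\Rightarrow\Delta,\alpha:@_n\varphi$. Rules (premises / conclusion): $(\mathsf{rep}_{=1})$ $\alpha:@_nm,\alpha:\varphi[n/k],\Gamma\Rightarrow\Delta$ / $\alpha:@_nm,\alpha:\varphi[m/k],\Gamma\Rightarrow\Delta$; $(\mathsf{rep}_{=2})$ $\alpha:@_nm,\alpha:\varphi[m/k],\Gamma\Rightarrow\Delta$ / $\alpha:@_nm,\alpha:\varphi[n/k],\Gamma\Rightarrow\Delta$;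 $(\mathsf{ref}_=)$ $\alpha:@_nn,\Gamma\Rightarrow\Delta$ / $\Gamma\Rightarrow\Delta$; $(\mathsf{rigid}_=)$ $\beta:@_nm,\Gamma\Rightarrow\Delta$ / $\alpha:@_nm,\Gamma\Rightarrow\Delta$; $(\to R)$ $\alpha:@_n\varphi,\Gamma\Rightarrow\Delta,\alpha:@_n\psi$ / $\Gamma\Rightarrow\Delta,\alpha:@_n(\varphi\to\psi)$; $(\to L)$ $\Gamma\Rightarrow\Delta,\alpha:@_n\varphi$ and $\alpha:@_n\psi,\Gamma\Rightarrow\Delta$ / $\alpha:@_n(\varphi\to\psi),\Gamma\Rightarrow\Delta$; $(@R)$ $\Gamma\Rightarrow\Delta,\alpha:@_m\varphi$ / $\Gamma\Rightarrow\Delta,\alpha:@_n@_m\varphi$; $(@L)$ $\alpha:@_m\varphi,\Gamma\Rightarrow\Delta$ / $\alpha:@_n@_m\varphi,\Gamma\Rightarrow\Delta$; $(\mathsf{F}R)$ $\alpha:@_n\langle\mathsf{F}\rangle m,\Gamma\Rightarrow\Delta,\alpha:@_m\varphi$ / $\Gamma\Rightarrow\Delta,\alpha:@_n\mathsf{F}\varphi$, $m$ not in the conclusion; $(\mathsf{F}L)$ $\Gamma\Rightarrow\Delta,\alpha:@_n\langle\mathsf{F}\rangle m$ and $\alpha:@_m\varphi,\Gamma\Rightarrow\Delta$ / $\alpha:@_n\mathsf{F}\varphi,\Gamma\Rightarrow\Delta$; $(\Box R)$ $\Gamma\stackrel{\mathcal{T}\cup\{\alpha\cdot_ni\}}{\Rightarrow}\Delta,\alpha\cdot_ni:@_n\varphi$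 / $\Gamma\stackrel{\mathcal{T}}{\Rightarrow}\Delta,\alpha:@_n\Box\varphi$, $i$ fresh in the conclusion; $(\Box L)$ $\beta:@_n\varphi,\Gamma\Rightarrow\Delta$ / $\alpha:@_n\Box\varphi,\Gamma\Rightarrow\Delta$, $\beta$ an $n$-child of $\alpha$; $(w\mathsf{lab})$ $\Gamma\stackrel{\mathcal{T}}{\Rightarrow}\Delta$ / $\Gamma\stackrel{\mathcal{T}\cup\{\alpha\}}{\Rightarrow}\Delta$ if $\mathcal{T}\cup\{\alpha\}$ is a tree; $(Cut)$ $\Gamma\Rightarrow\Delta,\alpha:@_n\varphi$ and $\alpha:@_n\varphi,\Pi\Rightarrow\Sigma$ / $\Gamma,\Pi\Rightarrow\Delta,\Sigma$. Provable = root of a finite derivation. -}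

module Defs where

open import Data.Nat using (ℕ)
open import Data.Product using (Σ; ∃; _×_; _,_)
open import Data.Sum using (_⊎_)
open import Data.Empty using (⊥)
open import Data.List using (List; []; _∷_; _++_)
open import Data.List.Membership.Propositional using (_∈_; _∉_)
open import Data.List.Relation.Unary.All using (All)
open import Data.List.Relation.Binary.Subset.Propositional using (_⊆_)
open import Relation.Binary.PropositionalEquality using (_≡_)
open import Relation.Nullary using (¬_; Dec; yes; no)
open import Data.Nat using (_≟_)

-- Syntax.  Prop and Nom are two disjoint countably infinite sets:
-- both are indexed by ℕ, but kept apart by distinct constructors.

Nom : Set
Nom = ℕ

PropVar : Set
PropVar = ℕ

data Form : Set where
  nom  : Nom → Form
  prop : PropVar → Form
  bot  : Form
  _⇒_  : Form → Form → Form
  at   : Nom → Form → Form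
  F    : Form → Form
  box  : Form → Form

infixr 5 _⇒_

neg : Form → Form
neg φ = φ ⇒ bot

dF : Form → Form
dF φ = neg (F (neg φ))

substN : Nom → Nom → Nom → Nom
substN m k a with a ≟ k
... | yes _ = m
... | no  _ = a

subst : Nom → Nom → Form → Form
subst m k (nom a)   = nom (substN m k a)
subst m k (prop p)  = prop p
subst m k bot       = bot
subst m k (φ ⇒ ψ)   = subst m k φ ⇒ subst m k ψ
subst m k (at a φ)  = at (substN m k a) (subst m k φ)
subst m k (F φ)     = F (subst m k φ)
subst m k (box φ)   = box (subst m k φ)

OccF : Nom → Form → Set
OccF m (nom a)  = m ≡ a
OccF m (prop p) = ⊥
OccF m bot      = ⊥
OccF m (φ ⇒ ψ)  = OccF m φ ⊎ OccF m ψ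
OccF m (at a φ) = m ≡ a ⊎ OccF m φ
OccF m (F φ)    = OccF m φ
OccF m (box φ)  = OccF m φ

data Label : Set where
  root  : ℕ → Label
  child : Label → Nom → ℕ → Label      -- child α n i  =  α ·_n i

OccLab : Nom → Label → Set
OccLab m (root k)      = ⊥
OccLab m (child α n i) = m ≡ n ⊎ OccLab m α

IsTree : List Label → Set
IsTree T =
  (Σ ℕ λ k → (root k ∈ T) × (∀ k' → root k' ∈ T → k' ≡ k)) ×
  (∀ α n i → child α n i ∈ T → α ∈ T)

-- Labelled formulas  α : @_n φ  are represented as  lf α n φ

record LF : Set where
  constructor lf
  field
    lbl : Label
    nm  : Nom
    fm  : Form
open LF public

substLF : Nom → Nom → LF → LF
substLF m k (lf α a φ) = lf α (substN m k a) (subst m k φ)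

OccLF : Nom → LF → Set
OccLF m (lf α a φ) = OccLab m α ⊎ OccF m (at a φ)

WF : List LF → List Label → List LF → Set
WF Γ T Δ = IsTree T × All (λ x → lbl x ∈ T) Γ × All (λ x → lbl x ∈ T) Δ

FreshNom : Nom → List LF → List Label → List LF → Set
FreshNom m Γ T Δ =
  All (λ x → ¬ OccLF m x) Γ × All (λ x → ¬ OccLF m x) Δ ×
  All (λ β → ¬ OccLab m β) T

_≈ˢ_ : {A : Set} → List A → List A → Set
xs ≈ˢ ys = (xs ⊆ ys) × (ys ⊆ xs)

-- Every node carries the tree-sequent condition.
-- Γ, Δ, T are sets, represented by lists; the rule `set` identifies lists
-- with the same elements.  "x , Γ" is written x ∷ Γ.

data Prov : List LF → List Label → List LF → Set where
  set    : ∀ {Γ Γ' T T' Δ Δ'} → Γ ≈ˢ Γ' → T ≈ˢ T' → Δ ≈ˢ Δ' →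
           Prov Γ' T' Δ' → Prov Γ T Δ
  init⊥  : ∀ {α n Γ T Δ} → WF (lf α n bot ∷ Γ) T Δ →
           Prov (lf α n bot ∷ Γ) T Δ
  initId : ∀ {α n φ Γ T Δ} → WF (lf α n φ ∷ Γ) T (lf α n φ ∷ Δ) →
           Prov (lf α n φ ∷ Γ) T (lf α n φ ∷ Δ)
  rep=1  : ∀ {α n m k ψ Γ T Δ} → lbl ψ ≡ α →
           WF (lf α n (nom m) ∷ substLF m k ψ ∷ Γ) T Δ →
           Prov (lf α n (nom m) ∷ substLF n k ψ ∷ Γ) T Δ →
           Prov (lf α n (nom m) ∷ substLF m k ψ ∷ Γ) T Δ
  rep=2  : ∀ {α n m k ψ Γ T Δ} → lbl ψ ≡ α →
           WF (lf α n (nom m) ∷ substLF n k ψ ∷ Γ) T Δ →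
           Prov (lf α n (nom m) ∷ substLF m k ψ ∷ Γ) T Δ →
           Prov (lf α n (nom m) ∷ substLF n k ψ ∷ Γ) T Δ
  ref=   : ∀ {α n Γ T Δ} → α ∈ T → WF Γ T Δ →
           Prov (lf α n (nom n) ∷ Γ) T Δ → Prov Γ T Δ
  rigid= : ∀ {α β n m Γ T Δ} → β ∈ T → WF (lf α n (nom m) ∷ Γ) T Δ →
           Prov (lf β n (nom m) ∷ Γ) T Δ →
           Prov (lf α n (nom m) ∷ Γ) T Δ
  →R     : ∀ {α n φ ψ Γ T Δ} → WF Γ T (lf α n (φ ⇒ ψ) ∷ Δ) →
           Prov (lf α n φ ∷ Γ) T (lf α n ψ ∷ Δ) →
           Prov Γ T (lf α n (φ ⇒ ψ) ∷ Δ)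
  →L     : ∀ {α n φ ψ Γ T Δ} → WF (lf α n (φ ⇒ ψ) ∷ Γ) T Δ →
           Prov Γ T (lf α n φ ∷ Δ) →
           Prov (lf α n ψ ∷ Γ) T Δ →
           Prov (lf α n (φ ⇒ ψ) ∷ Γ) T Δ
  atR    : ∀ {α n m φ Γ T Δ} → WF Γ T (lf α n (at m φ) ∷ Δ) →
           Prov Γ T (lf α m φ ∷ Δ) →
           Prov Γ T (lf α n (at m φ) ∷ Δ)
  atL    : ∀ {α n m φ Γ T Δ} → WF (lf α n (at m φ) ∷ Γ) T Δ →
           Prov (lf α m φ ∷ Γ) T Δ →
           Prov (lf α n (at m φ) ∷ Γ) T Δ
  FR     : ∀ {α n m φ Γ T Δ} → WF Γ T (lf α n (F φ) ∷ Δ) →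
           FreshNom m Γ T (lf α n (F φ) ∷ Δ) →
           Prov (lf α n (dF (nom m)) ∷ Γ) T (lf α m φ ∷ Δ) →
           Prov Γ T (lf α n (F φ) ∷ Δ)
  FL     : ∀ {α n m φ Γ T Δ} → WF (lf α n (F φ) ∷ Γ) T Δ →
           Prov Γ T (lf α n (dF (nom m)) ∷ Δ) →
           Prov (lf α m φ ∷ Γ) T Δ →
           Prov (lf α n (F φ) ∷ Γ) T Δ
  □R     : ∀ {α n i φ Γ T Δ} → WF Γ T (lf α n (box φ) ∷ Δ) →
           child α n i ∉ T →
           Prov Γ (child α n i ∷ T) (lf (child α n i) n φ ∷ Δ) →
           Prov Γ T (lf α n (box φ) ∷ Δ)
  □L     : ∀ {α n i φ Γ T Δ} → WF (lf α n (box φ) ∷ Γ) T Δ →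
           Prov (lf (child α n i) n φ ∷ Γ) T Δ →
           Prov (lf α n (box φ) ∷ Γ) T Δ
  wlab   : ∀ {α Γ T Δ} → WF Γ (α ∷ T) Δ →
           Prov Γ T Δ → Prov Γ (α ∷ T) Δ
  cut    : ∀ {α n φ Γ Π T Δ Σ'} → WF (Γ ++ Π) T (Δ ++ Σ') →
           Prov Γ T (lf α n φ ∷ Δ) →
           Prov (lf α n φ ∷ Π) T Σ' →
           Prov (Γ ++ Π) T (Δ ++ Σ')

-- Each of the four premises follows from the conclusion by a single cut against a
-- derivable sequent in which the principal formula is analysed by the opposite
-- rule: for (→R) the sequent @n(φ→ψ), @nφ ⇒ @nψ, for (□R) the sequent
-- α:@n□φ ⇒ α·ₙi:@nφ (after weakening the tree by α·ₙi), and for (@R), (@L)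
-- the sequents @n@mφ ⇒ @mφ and @mφ ⇒ @n@mφ.
module Submission where

open import Defs
open import Data.Nat using (ℕ)
open import Data.Product using (_×_; _,_)
open import Data.List using (List; []; _∷_; _++_)
open import Data.List.Membership.Propositional using (_∈_; _∉_)
open import Data.List.Relation.Unary.All using (All; []; _∷_) renaming (map to All-map)
open import Data.List.Relation.Unary.All.Properties using (anti-mono; ++⁺)
open import Data.List.Relation.Unary.Any using (here; there)
open import Data.List.Relation.Binary.Permutation.Propositional using (_↭_; ↭-sym)
open import Data.List.Relation.Binary.Permutation.Propositional.Properties using (∈-resp-↭; ++-comm)
open import Relation.Binary.PropositionalEquality using (_≡_; refl)

↭⇒≈ˢ : {A : Set} {xs ys : List A} → xs ↭ ys → xs ≈ˢ ys
↭⇒≈ˢ p = ∈-resp-↭ p , ∈-resp-↭ (↭-sym p)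

IsTree-resp-≈ˢ : {T T' : List Label} → T ≈ˢ T' → IsTree T' → IsTree T
IsTree-resp-≈ˢ (T⊆T' , T'⊆T) ((k , k∈ , unique) , closed) =
  (k , T'⊆T k∈ , λ k' k'∈ → unique k' (T⊆T' k'∈)) ,
  λ α n i c∈ → T'⊆T (closed α n i (T⊆T' c∈))

IsTree-∷-child : ∀ {T α} n i → IsTree T → α ∈ T → IsTree (child α n i ∷ T)
IsTree-∷-child {T} {α} n i ((k , k∈ , unique) , closed) α∈ =
  (k , there k∈ , unique′) , closed′
  where
  unique′ : ∀ k' → root k' ∈ child α n i ∷ T → k' ≡ k
  unique′ k' (here ())
  unique′ k' (there k'∈) = unique k' k'∈
  closed′ : ∀ β m j → child β m j ∈ child α n i ∷ T → β ∈ child α n i ∷ T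
  closed′ β m j (here refl) = there α∈
  closed′ β m j (there c∈) = there (closed β m j c∈)

WF-resp-≈ˢ : ∀ {Γ Γ' T T' Δ Δ'} → Γ ≈ˢ Γ' → T ≈ˢ T' → Δ ≈ˢ Δ' →
             WF Γ' T' Δ' → WF Γ T Δ
WF-resp-≈ˢ (Γ⊆ , _) T≈@(_ , T'⊆T) (Δ⊆ , _) (tree , labΓ , labΔ) =
  IsTree-resp-≈ˢ T≈ tree ,
  All-map T'⊆T (anti-mono Γ⊆ labΓ) ,
  All-map T'⊆T (anti-mono Δ⊆ labΔ)

Prov⇒WF : ∀ {Γ T Δ} → Prov Γ T Δ → WF Γ T Δ
Prov⇒WF (set Γ≈ T≈ Δ≈ p) = WF-resp-≈ˢ Γ≈ T≈ Δ≈ (Prov⇒WF p)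
Prov⇒WF (init⊥ w)      = w
Prov⇒WF (initId w)     = w
Prov⇒WF (rep=1 _ w _)  = w
Prov⇒WF (rep=2 _ w _)  = w
Prov⇒WF (ref= _ w _)   = w
Prov⇒WF (rigid= _ w _) = w
Prov⇒WF (→R w _)       = w
Prov⇒WF (→L w _ _)     = w
Prov⇒WF (atR w _)      = w
Prov⇒WF (atL w _)      = w
Prov⇒WF (FR w _ _)     = w
Prov⇒WF (FL w _ _)     = w
Prov⇒WF (□R w _ _)     = w
Prov⇒WF (□L w _)       = w
Prov⇒WF (wlab w _)     = w
Prov⇒WF (cut w _ _)    = w

Prov-resp-↭ : ∀ {Γ Γ' T Δ Δ'} → Γ ↭ Γ' → Δ ↭ Δ' → Prov Γ T Δ → Prov Γ' T Δ'
Prov-resp-↭ Γ↭ Δ↭ = set (↭⇒≈ˢ (↭-sym Γ↭)) ((λ β∈ → β∈) , (λ β∈ → β∈)) (↭⇒≈ˢ (↭-sym Δ↭))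

cut′ : ∀ {a Γ Π T Δ Σ} → Prov Γ T (a ∷ Δ) → Prov (a ∷ Π) T Σ → Prov (Γ ++ Π) T (Δ ++ Σ)
cut′ p q with Prov⇒WF p | Prov⇒WF q
... | tree , labΓ , _ ∷ labΔ | _ , _ ∷ labΠ , labΣ =
  cut (tree , ++⁺ labΓ labΠ , ++⁺ labΔ labΣ) p q

cut-swap : ∀ {a Γ Π T Δ Σ} → Prov Γ T (a ∷ Δ) → Prov (a ∷ Π) T Σ → Prov (Π ++ Γ) T (Σ ++ Δ)
cut-swap {Γ = Γ} {Π} {Δ = Δ} {Σ} p q = Prov-resp-↭ (++-comm Γ Π) (++-comm Δ Σ) (cut′ p q)

module _ {T : List Label} {α : Label} (tree : IsTree T) (α∈ : α ∈ T) where

  ⇒-elim : ∀ n φ ψ → Prov (lf α n (φ ⇒ ψ) ∷ lf α n φ ∷ []) T (lf α n ψ ∷ [])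
  ⇒-elim n φ ψ =
    →L (tree , α∈ ∷ α∈ ∷ [] , α∈ ∷ [])
       (initId (tree , α∈ ∷ [] , α∈ ∷ α∈ ∷ []))
       (initId (tree , α∈ ∷ α∈ ∷ [] , α∈ ∷ []))

  at-elim : ∀ n m φ → Prov (lf α n (at m φ) ∷ []) T (lf α m φ ∷ [])
  at-elim n m φ = atL (tree , α∈ ∷ [] , α∈ ∷ []) (initId (tree , α∈ ∷ [] , α∈ ∷ []))

  at-intro : ∀ n m φ → Prov (lf α m φ ∷ []) T (lf α n (at m φ) ∷ [])
  at-intro n m φ = atR (tree , α∈ ∷ [] , α∈ ∷ []) (initId (tree , α∈ ∷ [] , α∈ ∷ []))

  box-elim : ∀ n i φ → Prov (lf α n (box φ) ∷ []) (child α n i ∷ T) (lf (child α n i) n φ ∷ [])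
  box-elim n i φ =
    □L (tree′ , there α∈ ∷ [] , here refl ∷ []) (initId (tree′ , here refl ∷ [] , here refl ∷ []))
    where tree′ = IsTree-∷-child n i tree α∈

→R-inv : ∀ {Γ Δ T α n φ ψ} →
         Prov Γ T (lf α n (φ ⇒ ψ) ∷ Δ) → Prov (lf α n φ ∷ Γ) T (lf α n ψ ∷ Δ)
→R-inv {n = n} {φ} {ψ} p with Prov⇒WF p
... | tree , _ , α∈ ∷ _ = cut-swap p (⇒-elim tree α∈ n φ ψ)

□R-inv : ∀ {Γ Δ T α n φ} i →
         Prov Γ T (lf α n (box φ) ∷ Δ) → Prov Γ (child α n i ∷ T) (lf (child α n i) n φ ∷ Δ)
□R-inv {Γ} {Δ} {T} {α} {n} {φ} i p with Prov⇒WF p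
... | tree , labΓ , α∈ ∷ labΔ = cut-swap weakened (box-elim tree α∈ n i φ)
  where
  weakened : Prov Γ (child α n i ∷ T) (lf α n (box φ) ∷ Δ)
  weakened = wlab (IsTree-∷-child n i tree α∈ , All-map there labΓ , there α∈ ∷ All-map there labΔ) p

atR-inv : ∀ {Γ Δ T α n m φ} → Prov Γ T (lf α n (at m φ) ∷ Δ) → Prov Γ T (lf α m φ ∷ Δ)
atR-inv {n = n} {m} {φ} p with Prov⇒WF p
... | tree , _ , α∈ ∷ _ = cut-swap p (at-elim tree α∈ n m φ)

atL-inv : ∀ {Γ Δ T α n m φ} → Prov (lf α n (at m φ) ∷ Γ) T Δ → Prov (lf α m φ ∷ Γ) T Δ
atL-inv {n = n} {m} {φ} p with Prov⇒WF p
... | tree , α∈ ∷ _ , _ = cut′ (at-intro tree α∈ n m φ) p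

lemma3 :
      (∀ (Γ Δ : List LF) (T : List Label) (α : Label) (n : Nom) (φ ψ : Form) →
         Prov Γ T (lf α n (φ ⇒ ψ) ∷ Δ) →
         Prov (lf α n φ ∷ Γ) T (lf α n ψ ∷ Δ))
    × (∀ (Γ Δ : List LF) (T : List Label) (α : Label) (n : Nom) (φ : Form) (i : ℕ) →
         child α n i ∉ T →
         Prov Γ T (lf α n (box φ) ∷ Δ) →
         Prov Γ (child α n i ∷ T) (lf (child α n i) n φ ∷ Δ))
    × (∀ (Γ Δ : List LF) (T : List Label) (α : Label) (n m : Nom) (φ : Form) →
         Prov Γ T (lf α n (at m φ) ∷ Δ) →
         Prov Γ T (lf α m φ ∷ Δ))
    × (∀ (Γ Δ : List LF) (T : List Label) (α : Label) (n m : Nom) (φ : Form) →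
         Prov (lf α n (at m φ) ∷ Γ) T Δ →
         Prov (lf α m φ ∷ Γ) T Δ)
lemma3 =
    (λ _ _ _ _ _ _ _ → →R-inv)
  , (λ _ _ _ _ _ _ i _ → □R-inv i)
  , (λ _ _ _ _ _ _ _ → atR-inv)
  , (λ _ _ _ _ _ _ _ → atL-inv)
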